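{- The class of (countably infinite) prefix trees is not punctually robust: there is a computable prefix tree not isomorphic to any punctual prefix tree.
   Context: A prefix tree is a structure $\mathcal T=(T,R_1,R_2,R_3,\dots;r)$ in the infinite signature where each $R_n$ is an $n$-ary relation and $r\in T$, satisfying: (1) $R_1=\{r\}$; (2) if $R_n(a_1,\dots,a_n)$ and $1\le i\le n$ then $R_i(a_1,\dots,a_i)$. A structure with such an infinite signature is computable if its domain is a computable subset of $\mathbb N$ and the relations are uniformly computable. It is punctual if its domain is $\mathbb N$, all relations and constants are uniformly primitive recursive, and the function assigning to the index of a relation its arity is primitive recursive. A class is punctually robust if every computable member is isomorphic to a punctual structure. -}

module Defs where

open import Data.Nat using (ℕ; zero; suc; _+_; _*_; _^_; _≤_; _<_)
open import Data.Fin using (Fin)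
open import Data.Vec using (Vec; []; _∷_; lookup)
open import Data.List using (List; []; _∷_; length; take; map)
open import Data.List.Relation.Unary.All using (All)
open import Data.Bool using (Bool; true; false)
open import Data.Product using (Σ; ∃; _×_; _,_)
open import Relation.Binary.PropositionalEquality using (_≡_; _≢_)

data PR : ℕ → Set where
  pzero : ∀ {n} → PR n
  psucc : PR 1
  pproj : ∀ {n} → Fin n → PR n
  pcomp : ∀ {m n} → PR m → Vec (PR n) m → PR n
  prec  : ∀ {n} → PR n → PR (suc (suc n)) → PR (suc n)

mutual
  ⟦_⟧ : ∀ {n} → PR n → Vec ℕ n → ℕ
  ⟦ pzero ⟧ xs = 0
  ⟦ psucc ⟧ (x ∷ []) = suc x
  ⟦ pproj i ⟧ xs = lookup xs i
  ⟦ pcomp f gs ⟧ xs = ⟦ f ⟧ (⟦ gs ⟧* xs)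
  ⟦ prec g h ⟧ (zero ∷ xs) = ⟦ g ⟧ xs
  ⟦ prec g h ⟧ (suc k ∷ xs) = ⟦ h ⟧ (k ∷ ⟦ prec g h ⟧ (k ∷ xs) ∷ xs)

  ⟦_⟧* : ∀ {m n} → Vec (PR n) m → Vec ℕ n → Vec ℕ m
  ⟦ [] ⟧* xs = []
  ⟦ g ∷ gs ⟧* xs = ⟦ g ⟧ xs ∷ ⟦ gs ⟧* xs

data Rec : ℕ → Set where
  rzero : ∀ {n} → Rec n
  rsucc : Rec 1
  rproj : ∀ {n} → Fin n → Rec n
  rcomp : ∀ {m n} → Rec m → Vec (Rec n) m → Rec n
  rrec  : ∀ {n} → Rec n → Rec (suc (suc n)) → Rec (suc n)
  rmu   : ∀ {n} → Rec (suc n) → Rec n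

mutual
  data Eval : ∀ {n} → Rec n → Vec ℕ n → ℕ → Set where
    ev-zero : ∀ {n} {xs : Vec ℕ n} → Eval rzero xs 0
    ev-succ : ∀ {x} → Eval rsucc (x ∷ []) (suc x)
    ev-proj : ∀ {n} {i : Fin n} {xs} → Eval (rproj i) xs (lookup xs i)
    ev-comp : ∀ {m n} {f : Rec m} {gs : Vec (Rec n) m} {xs ys y} →
              Evals gs xs ys → Eval f ys y → Eval (rcomp f gs) xs y
    ev-rec0 : ∀ {n} {g : Rec n} {h xs y} →
              Eval g xs y → Eval (rrec g h) (zero ∷ xs) y
    ev-recS : ∀ {n} {g : Rec n} {h xs k z y} →
              Eval (rrec g h) (k ∷ xs) z → Eval h (k ∷ z ∷ xs) y →
              Eval (rrec g h) (suc k ∷ xs) y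
    ev-mu   : ∀ {n} {f : Rec (suc n)} {xs k} →
              Eval f (k ∷ xs) 0 →
              (∀ j → j < k → ∃ λ v → Eval f (j ∷ xs) (suc v)) →
              Eval (rmu f) xs k

  data Evals : ∀ {m n} → Vec (Rec n) m → Vec ℕ n → Vec ℕ m → Set where
    evs-[] : ∀ {n} {xs : Vec ℕ n} → Evals [] xs []
    evs-∷  : ∀ {m n} {g : Rec n} {gs : Vec (Rec n) m} {xs y ys} →
             Eval g xs y → Evals gs xs ys → Evals (g ∷ gs) xs (y ∷ ys)

Computable : (ℕ → ℕ) → Set
Computable f = Σ (Rec 1) λ c → ∀ x → Eval c (x ∷ []) (f x)

PrimRec : (ℕ → ℕ) → Set
PrimRec f = Σ (PR 1) λ c → ∀ x → ⟦ c ⟧ (x ∷ []) ≡ f x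

-- Coding of finite sequences of naturals (a primitive recursive bijection
-- List ℕ ≅ ℕ):  [] ↦ 0,  x ∷ xs ↦ 2^x * (2 * code xs + 1)

code : List ℕ → ℕ
code [] = 0
code (x ∷ xs) = 2 ^ x * (2 * code xs + 1)

b2n : Bool → ℕ
b2n true = 1
b2n false = 0

-- The domain is given by its characteristic function on ℕ; the family of
-- relations (R_n)_{n≥1} is given by one predicate on finite lists:
-- R_n(a₁,…,aₙ) holds iff rel (a₁ ∷ … ∷ aₙ ∷ []) ≡ true (n = length ≥ 1);
-- the value of rel on [] is irrelevant (there is no R₀).

record Str : Set where
  field
    dom  : ℕ → Bool
    rel  : List ℕ → Bool
    root : ℕ
open Str public

InDom : Str → ℕ → Set
InDom S x = dom S x ≡ true

record IsPrefixTree (S : Str) : Set where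
  field
    root-dom  : InDom S (root S)
    rel-dom   : ∀ xs → rel S xs ≡ true → All (InDom S) xs
    R₁-root   : rel S (root S ∷ []) ≡ true
    R₁-only   : ∀ x → rel S (x ∷ []) ≡ true → x ≡ root S
    prefix    : ∀ xs → rel S xs ≡ true →
                ∀ i → 1 ≤ i → i ≤ length xs → rel S (take i xs) ≡ true

Infinite : Str → Set
Infinite S = ∀ n → ∃ λ m → n ≤ m × InDom S m

IsComputable : Str → Set
IsComputable S =
  Computable (λ x → b2n (dom S x)) ×
  (Σ (ℕ → ℕ) λ g → Computable g × (∀ xs → g (code xs) ≡ b2n (rel S xs)))

-- punctual structure: domain ℕ, uniformly primitive recursive relations
-- (the constant is trivially primitive recursive, and the arity of R_n
-- is n, so the arity function is the identity)
IsPunctual : Str → Set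
IsPunctual S =
  (∀ x → InDom S x) ×
  (Σ (ℕ → ℕ) λ g → PrimRec g × (∀ xs → g (code xs) ≡ b2n (rel S xs)))

record Iso (A B : Str) : Set where
  field
    f        : ℕ → ℕ
    f-dom    : ∀ x → InDom A x → InDom B (f x)
    f-inj    : ∀ x y → InDom A x → InDom A y → f x ≡ f y → x ≡ y
    f-surj   : ∀ y → InDom B y → ∃ λ x → InDom A x × f x ≡ y
    f-root   : f (root A) ≡ root B
    f-rel    : ∀ xs → xs ≢ [] → All (InDom A) xs → rel A xs ≡ rel B (map f xs)

-- The tree has a spine (0), (0,0), (0,0,0), … and, below the spine node of length i + 1, a leaf
-- (0,…,0,1) exactly when φᵢ(i) = 0, where φₑ is the unary primitive recursive function with code e;
-- all other elements are isolated. The diagonal e ↦ φₑ(e) is computable: a primitive recursive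
-- machine runs an interpreter for codes and μ-search waits for it to halt. In a punctual copy of
-- the tree the root and the image of 1 are fixed numbers, so the existence of the leaf of length
-- i + 2 is decided by a primitive recursive function of i; if its code is e, then φₑ(e) would be
-- 1 exactly when φₑ(e) = 0.

module Submission where

open import Defs
open import Data.Bool using (Bool; true; false)
open import Data.Empty using (⊥-elim)
open import Data.Fin using (Fin; zero; suc; toℕ; #_)
open import Data.List using (List; []; _∷_; take; map; replicate; _++_)
open import Data.List.Properties using (map-++; map-replicate)
open import Data.List.Relation.Unary.All using (All; []; _∷_)
open import Data.Nat hiding (parity)
open import Data.Nat.GeneralisedArithmetic using (fold; fold-+)
open import Data.Nat.Properties
open import Data.Product using (Σ; ∃; _×_; _,_; proj₁)
open import Data.Sum using (_⊎_; inj₁; inj₂; [_,_]′)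
open import Data.Vec using (Vec; []; _∷_; lookup)
open import Function using (_∘_)
open import Relation.Binary.PropositionalEquality
open import Relation.Binary.Definitions using (tri<; tri≈; tri>)
open import Relation.Nullary using (¬_; yes; no)
open import Relation.Unary using (Decidable)

Fn : ℕ → Set
Fn n = Vec ℕ n → ℕ

PrimRecⁿ : ∀ n → Fn n → Set
PrimRecⁿ n f = Σ (PR n) λ c → ∀ xs → ⟦ c ⟧ xs ≡ f xs

uncurry₁ : (ℕ → ℕ) → Fn 1
uncurry₁ f (x ∷ []) = f x

uncurry₂ : (ℕ → ℕ → ℕ) → Fn 2
uncurry₂ f (x ∷ y ∷ []) = f x y

uncurry₃ : (ℕ → ℕ → ℕ → ℕ) → Fn 3
uncurry₃ f (x ∷ y ∷ z ∷ []) = f x y z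

uncurry₄ : (ℕ → ℕ → ℕ → ℕ → ℕ) → Fn 4
uncurry₄ f (x ∷ y ∷ z ∷ u ∷ []) = f x y z u

uncurry₅ : (ℕ → ℕ → ℕ → ℕ → ℕ → ℕ) → Fn 5
uncurry₅ f (x ∷ y ∷ z ∷ u ∷ v ∷ []) = f x y z u v

uncurry₆ : (ℕ → ℕ → ℕ → ℕ → ℕ → ℕ → ℕ) → Fn 6
uncurry₆ f (x ∷ y ∷ z ∷ u ∷ v ∷ w ∷ []) = f x y z u v w

pr-ext : ∀ {n} {f g : Fn n} → PrimRecⁿ n f → (∀ xs → f xs ≡ g xs) → PrimRecⁿ n g
pr-ext (c , p) f≗g = c , λ xs → trans (p xs) (f≗g xs)

applyAll : ∀ {m n} → Vec (Fn n) m → Vec ℕ n → Vec ℕ m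
applyAll []       xs = []
applyAll (g ∷ gs) xs = g xs ∷ applyAll gs xs

data AllPrimRec (n : ℕ) : ∀ {m} → Vec (Fn n) m → Set where
  []  : AllPrimRec n []
  _∷_ : ∀ {m g} {gs : Vec (Fn n) m} → PrimRecⁿ n g → AllPrimRec n gs → AllPrimRec n (g ∷ gs)

infixl 5 _∘ᵖ_
_∘ᵖ_ : ∀ {m n} {f : Fn m} {gs : Vec (Fn n) m} →
       PrimRecⁿ m f → AllPrimRec n gs → PrimRecⁿ n (λ xs → f (applyAll gs xs))
(c , p) ∘ᵖ rs = pcomp c (codes rs) , λ xs → trans (cong ⟦ c ⟧ (codes-correct rs xs)) (p _)
  where
  codes : ∀ {n m} {gs : Vec (Fn n) m} → AllPrimRec n gs → Vec (PR n) m
  codes []             = []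
  codes ((c , _) ∷ rs) = c ∷ codes rs
  codes-correct : ∀ {n m} {gs : Vec (Fn n) m} (rs : AllPrimRec n gs) xs →
                  ⟦ codes rs ⟧* xs ≡ applyAll gs xs
  codes-correct []             xs = refl
  codes-correct ((c , p) ∷ rs) xs = cong₂ _∷_ (p xs) (codes-correct rs xs)

comp₁ : ∀ {n f} {g : Fn n} → PrimRecⁿ 1 (uncurry₁ f) → PrimRecⁿ n g →
        PrimRecⁿ n (λ xs → f (g xs))
comp₁ r a = r ∘ᵖ (a ∷ [])

comp₂ : ∀ {n f} {g h : Fn n} → PrimRecⁿ 2 (uncurry₂ f) → PrimRecⁿ n g → PrimRecⁿ n h →
        PrimRecⁿ n (λ xs → f (g xs) (h xs))
comp₂ r a b = r ∘ᵖ (a ∷ b ∷ [])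

comp₃ : ∀ {n f} {g h k : Fn n} → PrimRecⁿ 3 (uncurry₃ f) →
        PrimRecⁿ n g → PrimRecⁿ n h → PrimRecⁿ n k → PrimRecⁿ n (λ xs → f (g xs) (h xs) (k xs))
comp₃ r a b c = r ∘ᵖ (a ∷ b ∷ c ∷ [])

var : ∀ {n} (i : Fin n) → PrimRecⁿ n (λ xs → lookup xs i)
var i = pproj i , λ xs → refl

pr-zero : ∀ {n} → PrimRecⁿ n (λ _ → 0)
pr-zero = pzero , λ xs → refl

pr-suc : PrimRecⁿ 1 (uncurry₁ suc)
pr-suc = psucc , λ { (x ∷ []) → refl }

pr-const : ∀ {n} k → PrimRecⁿ n (λ _ → k)
pr-const zero    = pr-zero
pr-const (suc k) = comp₁ pr-suc (pr-const k)

pr-rec : ∀ {n g h} (f : Fn (suc n)) → PrimRecⁿ n g → PrimRecⁿ (suc (suc n)) h →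
         (∀ xs → f (zero ∷ xs) ≡ g xs) →
         (∀ k xs → f (suc k ∷ xs) ≡ h (k ∷ f (k ∷ xs) ∷ xs)) → PrimRecⁿ (suc n) f
pr-rec f (cg , pg) (ch , ph) f-zero f-suc = prec cg ch , correct
  where
  correct : ∀ xs → ⟦ prec cg ch ⟧ xs ≡ f xs
  correct (zero ∷ xs)  = trans (pg xs) (sym (f-zero xs))
  correct (suc k ∷ xs) =
    trans (cong (λ v → ⟦ ch ⟧ (k ∷ v ∷ xs)) (correct (k ∷ xs))) (trans (ph _) (sym (f-suc k xs)))

pr-fold : ∀ {s} → PrimRecⁿ 1 (uncurry₁ s) → PrimRecⁿ 2 (uncurry₂ λ n z → fold z s n)
pr-fold r = pr-rec _ (var (# 0)) (comp₁ r (var (# 1)))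
                    (λ { (z ∷ []) → refl }) (λ { k (z ∷ []) → refl })

fold-suc : ∀ {A : Set} (z : A) (s : A → A) n → fold z s (suc n) ≡ fold (s z) s n
fold-suc z s n = trans (cong (fold z s) (+-comm 1 n)) (fold-+ z s n)

fold-fixed : ∀ {A : Set} {s : A → A} {z} → s z ≡ z → ∀ k → fold z s k ≡ z
fold-fixed fix zero    = refl
fold-fixed {s = s} fix (suc k) = trans (cong s (fold-fixed fix k)) fix

pr-+ : PrimRecⁿ 2 (uncurry₂ _+_)
pr-+ = pr-rec _ (var (# 0)) (comp₁ pr-suc (var (# 1)))
               (λ { (y ∷ []) → refl }) (λ { k (y ∷ []) → refl })

pr-* : PrimRecⁿ 2 (uncurry₂ _*_)
pr-* = pr-rec _ pr-zero (comp₂ pr-+ (var (# 2)) (var (# 1)))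
               (λ { (y ∷ []) → refl }) (λ { k (y ∷ []) → refl })

pr-pred : PrimRecⁿ 1 (uncurry₁ pred)
pr-pred = pr-rec _ pr-zero (var (# 0)) (λ { [] → refl }) (λ { k [] → refl })

pr-∸ : PrimRecⁿ 2 (uncurry₂ _∸_)
pr-∸ = pr-ext (comp₂ flipped (var (# 1)) (var (# 0))) λ { (x ∷ y ∷ []) → refl }
  where
  flipped : PrimRecⁿ 2 (uncurry₂ λ y x → x ∸ y)
  flipped = pr-rec _ (var (# 0)) (comp₁ pr-pred (var (# 1)))
            (λ { (x ∷ []) → refl }) (λ { k (x ∷ []) → sym (pred[m∸n]≡m∸[1+n] x k) })

ifz : ℕ → ℕ → ℕ → ℕ
ifz zero    x y = x
ifz (suc _) x y = y

pr-ifz : PrimRecⁿ 3 (uncurry₃ ifz)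
pr-ifz = pr-rec _ (var (# 0)) (var (# 3))
                 (λ { (x ∷ y ∷ []) → refl }) (λ { k (x ∷ y ∷ []) → refl })

∣-∣≡∸+∸ : ∀ m n → ∣ m - n ∣ ≡ (m ∸ n) + (n ∸ m)
∣-∣≡∸+∸ zero    zero    = refl
∣-∣≡∸+∸ zero    (suc n) = refl
∣-∣≡∸+∸ (suc m) zero    = sym (+-identityʳ (suc m))
∣-∣≡∸+∸ (suc m) (suc n) = ∣-∣≡∸+∸ m n

pr-∣-∣ : PrimRecⁿ 2 (uncurry₂ ∣_-_∣)
pr-∣-∣ = pr-ext
  (comp₂ pr-+ (comp₂ pr-∸ (var (# 0)) (var (# 1))) (comp₂ pr-∸ (var (# 1)) (var (# 0))))
  λ { (m ∷ n ∷ []) → sym (∣-∣≡∸+∸ m n) }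

ifeq : ℕ → ℕ → ℕ → ℕ → ℕ
ifeq a b x y = ifz ∣ a - b ∣ x y

ifeq-≡ : ∀ a x y → ifeq a a x y ≡ x
ifeq-≡ a x y = cong (λ d → ifz d x y) (∣n-n∣≡0 a)

ifeq-≢ : ∀ {a b} x y → a ≢ b → ifeq a b x y ≡ y
ifeq-≢ {a} {b} x y a≢b with ∣ a - b ∣ in eq
... | zero  = ⊥-elim (a≢b (∣m-n∣≡0⇒m≡n eq))
... | suc _ = refl

pr-ifeq : PrimRecⁿ 4 (uncurry₄ ifeq)
pr-ifeq = pr-ext (comp₃ pr-ifz (comp₂ pr-∣-∣ (var (# 0)) (var (# 1))) (var (# 2)) (var (# 3)))
                 λ { (a ∷ b ∷ x ∷ y ∷ []) → refl }

triangle : ℕ → ℕ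
triangle zero    = 0
triangle (suc n) = triangle n + suc n

row : ℕ → ℕ
row zero    = 0
row (suc z) = ifeq (suc z) (triangle (suc (row z))) (suc (row z)) (row z)

pair : ℕ → ℕ → ℕ
pair a b = triangle (a + b) + a

unpair₁ : ℕ → ℕ
unpair₁ z = z ∸ triangle (row z)

unpair₂ : ℕ → ℕ
unpair₂ z = row z ∸ unpair₁ z

n≤triangle : ∀ n → n ≤ triangle n
n≤triangle zero    = z≤n
n≤triangle (suc n) = m≤n+m (suc n) (triangle n)

triangle-mono : ∀ {m n} → m < n → triangle (suc m) ≤ triangle n
triangle-mono {m} {suc n} (s≤s m≤n) with m≤n⇒m<n∨m≡n m≤n
... | inj₁ m<n  = ≤-trans (triangle-mono m<n) (m≤m+n (triangle n) (suc n))
... | inj₂ refl = ≤-refl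

InRow : ℕ → ℕ → Set
InRow d z = triangle d ≤ z × z < triangle (suc d)

row-suc-≡ : ∀ {z} → suc z ≡ triangle (suc (row z)) → row (suc z) ≡ suc (row z)
row-suc-≡ {z} e = trans (cong (λ t → ifeq (suc z) t (suc (row z)) (row z)) (sym e)) (ifeq-≡ (suc z) _ _)

row-suc-≢ : ∀ {z} → suc z ≢ triangle (suc (row z)) → row (suc z) ≡ row z
row-suc-≢ ne = ifeq-≢ _ _ ne

row-correct : ∀ z → InRow (row z) z
row-correct zero    = z≤n , s≤s z≤n
row-correct (suc z) with row-correct z | suc z ≟ triangle (suc (row z))
... | _ , _ | yes 1+z≡t = subst (λ d → InRow d (suc z)) (sym (row-suc-≡ 1+z≡t))
  (≤-reflexive (sym 1+z≡t) , subst (_< triangle (suc (suc (row z)))) (sym 1+z≡t) (m<m+n _ z<s))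
... | lo , hi | no 1+z≢t = subst (λ d → InRow d (suc z)) (sym (row-suc-≢ 1+z≢t))
  (m≤n⇒m≤1+n lo , ≤∧≢⇒< hi 1+z≢t)

InRow-unique : ∀ {m n z} → InRow m z → InRow n z → m ≡ n
InRow-unique {m} {n} (lo₁ , hi₁) (lo₂ , hi₂) with <-cmp m n
... | tri≈ _ m≡n _ = m≡n
... | tri< m<n _ _ = ⊥-elim (<-irrefl refl (<-≤-trans hi₁ (≤-trans (triangle-mono m<n) lo₂)))
... | tri> _ _ n<m = ⊥-elim (<-irrefl refl (<-≤-trans hi₂ (≤-trans (triangle-mono n<m) lo₁)))

row-pair : ∀ a b → row (pair a b) ≡ a + b
row-pair a b = InRow-unique (row-correct (pair a b))
  (m≤m+n _ a , +-monoʳ-< (triangle (a + b)) (s≤s (m≤m+n a b)))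

unpair₁-pair : ∀ a b → unpair₁ (pair a b) ≡ a
unpair₁-pair a b rewrite row-pair a b = m+n∸m≡n (triangle (a + b)) a

unpair₂-pair : ∀ a b → unpair₂ (pair a b) ≡ b
unpair₂-pair a b rewrite unpair₁-pair a b | row-pair a b = m+n∸m≡n a b

unpair₁-≤ : ∀ z → unpair₁ z ≤ z
unpair₁-≤ z = m∸n≤m z (triangle (row z))

unpair₂-≤ : ∀ z → unpair₂ z ≤ z
unpair₂-≤ z =
  ≤-trans (m∸n≤m (row z) (unpair₁ z)) (≤-trans (n≤triangle (row z)) (proj₁ (row-correct z)))

pr-triangle : PrimRecⁿ 1 (uncurry₁ triangle)
pr-triangle = pr-rec _ pr-zero (comp₂ pr-+ (var (# 1)) (comp₁ pr-suc (var (# 0))))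
                     (λ { [] → refl }) (λ { k [] → refl })

pr-row : PrimRecⁿ 1 (uncurry₁ row)
pr-row = pr-rec _ pr-zero
  (pr-ifeq ∘ᵖ (comp₁ pr-suc (var (# 0)) ∷ comp₁ pr-triangle (comp₁ pr-suc (var (# 1)))
              ∷ comp₁ pr-suc (var (# 1)) ∷ var (# 1) ∷ []))
  (λ { [] → refl }) (λ { k [] → refl })

pr-unpair₁ : PrimRecⁿ 1 (uncurry₁ unpair₁)
pr-unpair₁ = pr-ext (comp₂ pr-∸ (var (# 0)) (comp₁ pr-triangle (comp₁ pr-row (var (# 0)))))
                    λ { (z ∷ []) → refl }

pr-unpair₂ : PrimRecⁿ 1 (uncurry₁ unpair₂)
pr-unpair₂ = pr-ext (comp₂ pr-∸ (comp₁ pr-row (var (# 0))) (comp₁ pr-unpair₁ (var (# 0))))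
                    λ { (z ∷ []) → refl }

-- ⟨ a , b ⟩ is never 0, so 0 serves as the empty list and the empty stack.
abstract
  ⟨_,_⟩ : ℕ → ℕ → ℕ
  ⟨ a , b ⟩ = suc (pair a b)

  π₁ : ℕ → ℕ
  π₁ z = unpair₁ (pred z)

  π₂ : ℕ → ℕ
  π₂ z = unpair₂ (pred z)

  π₁-⟨⟩ : ∀ a b → π₁ ⟨ a , b ⟩ ≡ a
  π₁-⟨⟩ = unpair₁-pair

  π₂-⟨⟩ : ∀ a b → π₂ ⟨ a , b ⟩ ≡ b
  π₂-⟨⟩ = unpair₂-pair

  ifz-⟨⟩ : ∀ a b (x y : ℕ) → ifz ⟨ a , b ⟩ x y ≡ y
  ifz-⟨⟩ a b x y = refl

  <-⟨⟩ˡ : ∀ a b → a < ⟨ a , b ⟩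
  <-⟨⟩ˡ a b = s≤s (m≤n+m a (triangle (a + b)))

  <-⟨⟩ʳ : ∀ a b → b < ⟨ a , b ⟩
  <-⟨⟩ʳ a b = s≤s (≤-trans (m≤n+m b a) (≤-trans (n≤triangle (a + b)) (m≤m+n (triangle (a + b)) a)))

  π₁-< : ∀ z → π₁ (suc z) < suc z
  π₁-< z = s≤s (unpair₁-≤ z)

  π₂-< : ∀ z → π₂ (suc z) < suc z
  π₂-< z = s≤s (unpair₂-≤ z)

  π₁-zero : π₁ 0 ≡ 0
  π₁-zero = refl

  π₂-zero : π₂ 0 ≡ 0
  π₂-zero = refl

  pr-⟨⟩ : PrimRecⁿ 2 (uncurry₂ ⟨_,_⟩)
  pr-⟨⟩ = pr-ext
    (comp₁ pr-suc (comp₂ pr-+ (comp₁ pr-triangle (comp₂ pr-+ (var (# 0)) (var (# 1)))) (var (# 0))))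
    λ { (a ∷ b ∷ []) → refl }

  pr-π₁ : PrimRecⁿ 1 (uncurry₁ π₁)
  pr-π₁ = pr-ext (comp₁ pr-unpair₁ (comp₁ pr-pred (var (# 0)))) λ { (z ∷ []) → refl }

  pr-π₂ : PrimRecⁿ 1 (uncurry₁ π₂)
  pr-π₂ = pr-ext (comp₁ pr-unpair₂ (comp₁ pr-pred (var (# 0)))) λ { (z ∷ []) → refl }

π₁-≤ : ∀ z → π₁ z ≤ z
π₁-≤ zero    = ≤-reflexive π₁-zero
π₁-≤ (suc z) = <⇒≤ (π₁-< z)

π₂-≤ : ∀ z → π₂ z ≤ z
π₂-≤ zero    = ≤-reflexive π₂-zero
π₂-≤ (suc z) = <⇒≤ (π₂-< z)

π₁ᵖ : ∀ {n} {g : Fn n} → PrimRecⁿ n g → PrimRecⁿ n (λ xs → π₁ (g xs))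
π₁ᵖ = comp₁ pr-π₁

π₂ᵖ : ∀ {n} {g : Fn n} → PrimRecⁿ n g → PrimRecⁿ n (λ xs → π₂ (g xs))
π₂ᵖ = comp₁ pr-π₂

⟨_,_⟩ᵖ : ∀ {n} {g h : Fn n} → PrimRecⁿ n g → PrimRecⁿ n h → PrimRecⁿ n (λ xs → ⟨ g xs , h xs ⟩)
⟨_,_⟩ᵖ = comp₂ pr-⟨⟩

leastBelow : ∀ {P : ℕ → Set} → Decidable P → ∀ n →
             (∃ λ k → k < n × P k × (∀ j → j < k → ¬ P j)) ⊎ (∀ j → j < n → ¬ P j)
leastBelow P? zero = inj₂ λ _ ()
leastBelow P? (suc n) with leastBelow P? n
... | inj₁ (k , k<n , pk , before) = inj₁ (k , m<n⇒m<1+n k<n , pk , before)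
... | inj₂ none with P? n
...   | yes pn  = inj₁ (n , ≤-refl , pn , none)
...   | no  ¬pn = inj₂ λ j j<1+n → [ none j , (λ { refl → ¬pn }) ]′ (m<1+n⇒m<n∨m≡n j<1+n)

least : ∀ {P : ℕ → Set} → Decidable P → ∀ {n} → P n → ∃ λ k → P k × (∀ j → j < k → ¬ P j)
least P? {n} pn with leastBelow P? (suc n)
... | inj₁ (k , _ , pk , before) = k , pk , before
... | inj₂ none = ⊥-elim (none n ≤-refl pn)

mutual
  embed : ∀ {n} → PR n → Rec n
  embed pzero        = rzero
  embed psucc        = rsucc
  embed (pproj i)    = rproj i
  embed (pcomp f gs) = rcomp (embed f) (embedAll gs)
  embed (prec g h)   = rrec (embed g) (embed h)

  embedAll : ∀ {m n} → Vec (PR n) m → Vec (Rec n) m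
  embedAll []       = []
  embedAll (g ∷ gs) = embed g ∷ embedAll gs

mutual
  embed-eval : ∀ {n} (c : PR n) xs → Eval (embed c) xs (⟦ c ⟧ xs)
  embed-eval pzero        xs            = ev-zero
  embed-eval psucc        (x ∷ [])      = ev-succ
  embed-eval (pproj i)    xs            = ev-proj
  embed-eval (pcomp f gs) xs            = ev-comp (embedAll-evals gs xs) (embed-eval f _)
  embed-eval (prec g h)   (zero ∷ xs)   = ev-rec0 (embed-eval g xs)
  embed-eval (prec g h)   (suc k ∷ xs)  = ev-recS (embed-eval (prec g h) (k ∷ xs)) (embed-eval h _)

  embedAll-evals : ∀ {m n} (gs : Vec (PR n) m) xs → Evals (embedAll gs) xs (⟦ gs ⟧* xs)
  embedAll-evals []       xs = evs-[]
  embedAll-evals (g ∷ gs) xs = evs-∷ (embed-eval g xs) (embedAll-evals gs xs)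

primRec-eval : ∀ {n f} (r : PrimRecⁿ n f) xs → Eval (embed (proj₁ r)) xs (f xs)
primRec-eval (c , p) xs = subst (Eval (embed c) xs) (p xs) (embed-eval c xs)

≢0⇒≡suc : ∀ {n} → n ≢ 0 → ∃ λ v → n ≡ suc v
≢0⇒≡suc {zero}  n≢0 = ⊥-elim (n≢0 refl)
≢0⇒≡suc {suc n} _   = n , refl

μ-eval : ∀ {n f} (r : PrimRecⁿ (suc n) f) xs k →
         f (k ∷ xs) ≡ 0 → (∀ j → j < k → f (j ∷ xs) ≢ 0) → Eval (rmu (embed (proj₁ r))) xs k
μ-eval r xs k fk≡0 before = ev-mu (subst (Eval _ _) fk≡0 (primRec-eval r _)) λ j j<k →
  let (v , fj≡1+v) = ≢0⇒≡suc (before j j<k) in v , subst (Eval _ _) fj≡1+v (primRec-eval r _)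

minimise-computable : ∀ {r o : ℕ → ℕ → ℕ} {f : ℕ → ℕ} →
  PrimRecⁿ 2 (uncurry₂ r) → PrimRecⁿ 2 (uncurry₂ o) →
  (∀ x → ∃ λ s → r s x ≡ 0 × (∀ j → j < s → r j x ≢ 0) × o s x ≡ f x) → Computable f
minimise-computable pr-r pr-o spec =
  rcomp (embed (proj₁ pr-o)) (rmu (embed (proj₁ pr-r)) ∷ rproj zero ∷ []) ,
  λ x → let (s , rs≡0 , before , os≡fx) = spec x in
    ev-comp (evs-∷ (μ-eval pr-r (x ∷ []) s rs≡0 before) (evs-∷ ev-proj evs-[]))
            (subst (Eval _ _) os≡fx (primRec-eval pr-o (s ∷ x ∷ [])))

primRec⇒computable : ∀ {f : Fn 1} → PrimRecⁿ 1 f → Computable (λ x → f (x ∷ []))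
primRec⇒computable r = embed (proj₁ r) , λ x → primRec-eval r (x ∷ [])

computable-∘ : ∀ {f g} → Computable f → Computable g → Computable (λ x → f (g x))
computable-∘ {g = g} (cf , f-ok) (cg , g-ok) =
  rcomp cf (cg ∷ []) , λ x → ev-comp (evs-∷ (g-ok x) evs-[]) (f-ok (g x))

computable-app : ∀ {f : Fn 2} {g} → PrimRecⁿ 2 f → Computable g → Computable (λ x → f (x ∷ g x ∷ []))
computable-app {g = g} r (cg , g-ok) = rcomp (embed (proj₁ r)) (rproj zero ∷ cg ∷ []) ,
  λ x → ev-comp (evs-∷ ev-proj (evs-∷ (g-ok x) evs-[])) (primRec-eval r (x ∷ g x ∷ []))

prepend : ∀ {m} → Vec ℕ m → ℕ → ℕ
prepend []       acc = acc
prepend (v ∷ vs) acc = ⟨ v , prepend vs acc ⟩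

vecCode : ∀ {m} → Vec ℕ m → ℕ
vecCode xs = prepend xs 0

nth : ℕ → ℕ → ℕ
nth i xs = π₁ (fold xs π₂ i)

nth-vecCode : ∀ {m} (i : Fin m) (xs : Vec ℕ m) → nth (toℕ i) (vecCode xs) ≡ lookup xs i
nth-vecCode zero    (x ∷ xs) = π₁-⟨⟩ x _
nth-vecCode (suc i) (x ∷ xs) = begin
  π₁ (fold ⟨ x , vecCode xs ⟩ π₂ (suc (toℕ i)))  ≡⟨ cong π₁ (fold-suc _ π₂ (toℕ i)) ⟩
  π₁ (fold (π₂ ⟨ x , vecCode xs ⟩) π₂ (toℕ i))   ≡⟨ cong (nth (toℕ i)) (π₂-⟨⟩ x _) ⟩
  nth (toℕ i) (vecCode xs)                      ≡⟨ nth-vecCode i xs ⟩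
  lookup xs i                                   ∎
  where open ≡-Reasoning

-- The argument codes of a composition are stored in reverse, as evalArgs pushes each result
-- onto an accumulator.
mutual
  ⌜_⌝ : ∀ {n} → PR n → ℕ
  ⌜ pzero ⌝      = ⟨ 0 , 0 ⟩
  ⌜ psucc ⌝      = ⟨ 1 , 0 ⟩
  ⌜ pproj i ⌝    = ⟨ 2 , toℕ i ⟩
  ⌜ pcomp f gs ⌝ = ⟨ 3 , ⟨ ⌜ f ⌝ , revEncode gs 0 ⟩ ⟩
  ⌜ prec g h ⌝   = ⟨ 4 , ⟨ ⌜ g ⌝ , ⌜ h ⌝ ⟩ ⟩

  revEncode : ∀ {m n} → Vec (PR n) m → ℕ → ℕ
  revEncode []       acc = acc
  revEncode (g ∷ gs) acc = revEncode gs ⟨ ⌜ g ⌝ , acc ⟩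

revEncode-≥ : ∀ {m k} (gs : Vec (PR k) m) acc → m + acc ≤ revEncode gs acc
revEncode-≥ []               acc = ≤-refl
revEncode-≥ {suc m} (g ∷ gs) acc = begin
  suc m + acc          ≡⟨ sym (+-suc m acc) ⟩
  m + suc acc          ≤⟨ +-monoʳ-≤ m (<-⟨⟩ʳ ⌜ g ⌝ acc) ⟩
  m + ⟨ ⌜ g ⌝ , acc ⟩  ≤⟨ revEncode-≥ gs _ ⟩
  revEncode gs _       ∎
  where open ≤-Reasoning

-- eval n e xs runs code e on the argument list xs with fuel n; any n > e will do (eval-encode).
-- Tags 0, 1, 2, 3 and ≥ 4 stand for zero, successor, projection, composition and recursion.
-- evalArgs bounds its loop by the code of the list of argument codes, which exceeds its length.
mutual
  eval : ℕ → ℕ → ℕ → ℕ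
  eval zero    e xs = 0
  eval (suc n) e xs = evalBody n (π₁ e) (π₂ e) xs

  evalBody : ℕ → ℕ → ℕ → ℕ → ℕ
  evalBody n zero                            p xs = 0
  evalBody n (suc zero)                      p xs = suc (π₁ xs)
  evalBody n (suc (suc zero))                p xs = nth p xs
  evalBody n (suc (suc (suc zero)))          p xs = eval n (π₁ p) (evalArgs n (π₂ p) (π₂ p) xs 0)
  evalBody n (suc (suc (suc (suc _))))       p xs =
    evalRec n (π₂ p) (π₂ xs) (eval n (π₁ p) (π₂ xs)) (π₁ xs)

  evalArgs : ℕ → ℕ → ℕ → ℕ → ℕ → ℕ
  evalArgs n zero    gs xs acc = acc
  evalArgs n (suc m) gs xs acc = ifz gs acc (evalArgs n m (π₂ gs) xs ⟨ eval n (π₁ gs) xs , acc ⟩)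

  evalRec : ℕ → ℕ → ℕ → ℕ → ℕ → ℕ
  evalRec n h xs z zero    = z
  evalRec n h xs z (suc k) = eval n h ⟨ k , ⟨ evalRec n h xs z k , xs ⟩ ⟩

eval-⟨⟩ : ∀ n t p xs → eval (suc n) ⟨ t , p ⟩ xs ≡ evalBody n t p xs
eval-⟨⟩ n t p xs = cong₂ (λ a b → evalBody n a b xs) (π₁-⟨⟩ t p) (π₂-⟨⟩ t p)

evalArgs-nil : ∀ n m xs acc → evalArgs n m 0 xs acc ≡ acc
evalArgs-nil n zero    xs acc = refl
evalArgs-nil n (suc m) xs acc = refl

mutual
  eval-encode : ∀ {k} (c : PR k) {n} → ⌜ c ⌝ < n → ∀ xs → eval n ⌜ c ⌝ (vecCode xs) ≡ ⟦ c ⟧ xs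
  eval-encode pzero {suc n} _ xs = eval-⟨⟩ n 0 0 _
  eval-encode psucc {suc n} _ (x ∷ []) = trans (eval-⟨⟩ n 1 0 _) (cong suc (π₁-⟨⟩ x 0))
  eval-encode (pproj i) {suc n} _ xs = trans (eval-⟨⟩ n 2 _ _) (nth-vecCode i xs)
  eval-encode (pcomp {m} f gs) {suc n} (s≤s c<n) xs = begin
    eval (suc n) ⟨ 3 , q ⟩ (vecCode xs)                       ≡⟨ eval-⟨⟩ n 3 q _ ⟩
    eval n (π₁ q) (evalArgs n (π₂ q) (π₂ q) (vecCode xs) 0)
      ≡⟨ cong₂ (λ a b → eval n a (evalArgs n b b (vecCode xs) 0)) (π₁-⟨⟩ ⌜ f ⌝ R) (π₂-⟨⟩ ⌜ f ⌝ R) ⟩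
    eval n ⌜ f ⌝ (evalArgs n R R (vecCode xs) 0)              ≡⟨ cong (eval n ⌜ f ⌝) args ⟩
    eval n ⌜ f ⌝ (vecCode (⟦ gs ⟧* xs))                       ≡⟨ eval-encode f (<-trans (<-⟨⟩ˡ _ _) q<n) _ ⟩
    ⟦ f ⟧ (⟦ gs ⟧* xs)                                        ∎
    where
    open ≡-Reasoning
    R = revEncode gs 0
    q = ⟨ ⌜ f ⌝ , R ⟩
    q<n : q < n
    q<n = <-≤-trans (<-⟨⟩ʳ 3 q) c<n
    m≤R : m ≤ R
    m≤R = ≤-trans (m≤m+n m 0) (revEncode-≥ gs 0)
    args : evalArgs n R R (vecCode xs) 0 ≡ vecCode (⟦ gs ⟧* xs)
    args = begin
      evalArgs n R R (vecCode xs) 0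
        ≡⟨ cong (λ t → evalArgs n t R (vecCode xs) 0) (sym (m+[n∸m]≡n m≤R)) ⟩
      evalArgs n (m + (R ∸ m)) R (vecCode xs) 0   ≡⟨ evalArgs-revEncode gs {xs} (<-trans (<-⟨⟩ʳ _ _) q<n) ⟩
      evalArgs n (R ∸ m) 0 (vecCode xs) _         ≡⟨ evalArgs-nil n (R ∸ m) (vecCode xs) _ ⟩
      vecCode (⟦ gs ⟧* xs)                        ∎
  eval-encode (prec g h) {suc n} (s≤s c<n) (k ∷ xs) = begin
    eval (suc n) ⟨ 4 , q ⟩ ⟨ k , vecCode xs ⟩      ≡⟨ eval-⟨⟩ n 4 q _ ⟩
    evalRec n (π₂ q) (π₂ xs′) (eval n (π₁ q) (π₂ xs′)) (π₁ xs′)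
      ≡⟨ cong₂ (λ a b → evalRec n (π₂ q) b (eval n (π₁ q) b) a) (π₁-⟨⟩ k _) (π₂-⟨⟩ k _) ⟩
    evalRec n (π₂ q) (vecCode xs) (eval n (π₁ q) (vecCode xs)) k
      ≡⟨ cong₂ (λ a b → evalRec n b (vecCode xs) (eval n a (vecCode xs)) k)
               (π₁-⟨⟩ ⌜ g ⌝ ⌜ h ⌝) (π₂-⟨⟩ ⌜ g ⌝ ⌜ h ⌝) ⟩
    evalRec n ⌜ h ⌝ (vecCode xs) (eval n ⌜ g ⌝ (vecCode xs)) k ≡⟨ loop k ⟩
    ⟦ prec g h ⟧ (k ∷ xs)                          ∎
    where
    open ≡-Reasoning
    q = ⟨ ⌜ g ⌝ , ⌜ h ⌝ ⟩
    xs′ = ⟨ k , vecCode xs ⟩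
    q<n : q < n
    q<n = <-≤-trans (<-⟨⟩ʳ 4 q) c<n
    loop : ∀ j → evalRec n ⌜ h ⌝ (vecCode xs) (eval n ⌜ g ⌝ (vecCode xs)) j ≡ ⟦ prec g h ⟧ (j ∷ xs)
    loop zero    = eval-encode g (<-trans (<-⟨⟩ˡ _ _) q<n) xs
    loop (suc j) = trans (cong (λ z → eval n ⌜ h ⌝ ⟨ j , ⟨ z , vecCode xs ⟩ ⟩) (loop j))
                         (eval-encode h (<-trans (<-⟨⟩ʳ _ _) q<n) (j ∷ ⟦ prec g h ⟧ (j ∷ xs) ∷ xs))

  evalArgs-revEncode : ∀ {m k n fuel acc L} (gs : Vec (PR k) m) {xs : Vec ℕ k} → revEncode gs L < n →
    evalArgs n (m + fuel) (revEncode gs L) (vecCode xs) acc ≡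
    evalArgs n fuel L (vecCode xs) (prepend (⟦ gs ⟧* xs) acc)
  evalArgs-revEncode [] lt = refl
  evalArgs-revEncode {suc m} {n = n} {fuel} {acc} {L} (g ∷ gs) {xs} lt = begin
    evalArgs n (suc m + fuel) (revEncode gs L′) (vecCode xs) acc
      ≡⟨ cong (λ t → evalArgs n t (revEncode gs L′) (vecCode xs) acc) (sym (+-suc m fuel)) ⟩
    evalArgs n (m + suc fuel) (revEncode gs L′) (vecCode xs) acc     ≡⟨ evalArgs-revEncode gs {xs} lt ⟩
    evalArgs n (suc fuel) L′ (vecCode xs) (prepend (⟦ gs ⟧* xs) acc) ≡⟨ ifz-⟨⟩ ⌜ g ⌝ L _ _ ⟩
    evalArgs n fuel (π₂ L′) (vecCode xs) ⟨ eval n (π₁ L′) (vecCode xs) , prepend (⟦ gs ⟧* xs) acc ⟩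
      ≡⟨ cong₂ (λ a b → evalArgs n fuel a (vecCode xs) ⟨ eval n b (vecCode xs) , _ ⟩)
               (π₂-⟨⟩ ⌜ g ⌝ L) (π₁-⟨⟩ ⌜ g ⌝ L) ⟩
    evalArgs n fuel L (vecCode xs) ⟨ eval n ⌜ g ⌝ (vecCode xs) , prepend (⟦ gs ⟧* xs) acc ⟩
      ≡⟨ cong (λ v → evalArgs n fuel L (vecCode xs) ⟨ v , _ ⟩) (eval-encode g g<n xs) ⟩
    evalArgs n fuel L (vecCode xs) (prepend (⟦ g ∷ gs ⟧* xs) acc)    ∎
    where
    open ≡-Reasoning
    L′ = ⟨ ⌜ g ⌝ , L ⟩
    g<n : ⌜ g ⌝ < n
    g<n = <-≤-trans (<-⟨⟩ˡ ⌜ g ⌝ L) (≤-trans (≤-trans (m≤n+m _ m) (revEncode-≥ gs L′)) (<⇒≤ lt))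

pr-nth : PrimRecⁿ 2 (uncurry₂ nth)
pr-nth = pr-ext (π₁ᵖ (comp₂ (pr-fold pr-π₂) (var (# 0)) (var (# 1)))) λ { (i ∷ xs ∷ []) → refl }

-- A state pairs a mode with a stack of frames: evalState starts
-- evaluating a code, retState returns a value to the top frame. Each step is primitive recursive,
-- so it is only the number of steps that is unbounded.

evalState : ℕ → ℕ → ℕ → ℕ
evalState e xs K = ⟨ ⟨ 0 , ⟨ e , xs ⟩ ⟩ , K ⟩

retState : ℕ → ℕ → ℕ
retState v K = ⟨ ⟨ 1 , v ⟩ , K ⟩

compFrame : ℕ → ℕ → ℕ → ℕ → ℕ
compFrame f gs xs acc = ⟨ 0 , ⟨ f , ⟨ gs , ⟨ xs , acc ⟩ ⟩ ⟩ ⟩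

recFrame : ℕ → ℕ → ℕ → ℕ → ℕ
recFrame h k m xs = ⟨ 1 , ⟨ h , ⟨ k , ⟨ m , xs ⟩ ⟩ ⟩ ⟩

nextArg : ℕ → ℕ → ℕ → ℕ → ℕ → ℕ
nextArg f gs xs acc K =
  ifz gs (evalState f acc K) (evalState (π₁ gs) xs ⟨ compFrame f (π₂ gs) xs acc , K ⟩)

recLoop : ℕ → ℕ → ℕ → ℕ → ℕ → ℕ → ℕ
recLoop v h k m xs K =
  ifeq k m (retState v K) (evalState h ⟨ k , ⟨ v , xs ⟩ ⟩ ⟨ recFrame h (suc k) m xs , K ⟩)

resume : ℕ → ℕ → ℕ → ℕ → ℕ
resume v zero    b K = nextArg (π₁ b) (π₁ (π₂ b)) (π₁ (π₂ (π₂ b))) ⟨ v , π₂ (π₂ (π₂ b)) ⟩ K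
resume v (suc _) b K = recLoop v (π₁ b) (π₁ (π₂ b)) (π₁ (π₂ (π₂ b))) (π₂ (π₂ (π₂ b))) K

returnTo : ℕ → ℕ → ℕ
returnTo v K = ifz K (retState v K) (resume v (π₁ (π₁ K)) (π₂ (π₁ K)) (π₂ K))

dispatch : ℕ → ℕ → ℕ → ℕ → ℕ
dispatch zero                      p xs K = retState 0 K
dispatch (suc zero)                p xs K = retState (suc (π₁ xs)) K
dispatch (suc (suc zero))          p xs K = retState (nth p xs) K
dispatch (suc (suc (suc zero)))    p xs K = nextArg (π₁ p) (π₂ p) xs 0 K
dispatch (suc (suc (suc (suc _)))) p xs K =
  evalState (π₁ p) (π₂ xs) ⟨ recFrame (π₂ p) 0 (π₁ xs) (π₂ xs) , K ⟩

stepWith : ℕ → ℕ → ℕ → ℕ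
stepWith zero    c K = dispatch (π₁ (π₁ c)) (π₂ (π₁ c)) (π₂ c) K
stepWith (suc _) v K = returnTo v K

step : ℕ → ℕ
step st = stepWith (π₁ (π₁ st)) (π₂ (π₁ st)) (π₂ st)

pr-evalState : PrimRecⁿ 3 (uncurry₃ evalState)
pr-evalState = pr-ext ⟨ ⟨ pr-zero , ⟨ var (# 0) , var (# 1) ⟩ᵖ ⟩ᵖ , var (# 2) ⟩ᵖ
                      λ { (e ∷ xs ∷ K ∷ []) → refl }

pr-retState : PrimRecⁿ 2 (uncurry₂ retState)
pr-retState = pr-ext ⟨ ⟨ pr-const 1 , var (# 0) ⟩ᵖ , var (# 1) ⟩ᵖ λ { (v ∷ K ∷ []) → refl }

pr-compFrame : PrimRecⁿ 4 (uncurry₄ compFrame)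
pr-compFrame = pr-ext ⟨ pr-zero , ⟨ var (# 0) , ⟨ var (# 1) , ⟨ var (# 2) , var (# 3) ⟩ᵖ ⟩ᵖ ⟩ᵖ ⟩ᵖ
                      λ { (f ∷ gs ∷ xs ∷ acc ∷ []) → refl }

pr-recFrame : PrimRecⁿ 4 (uncurry₄ recFrame)
pr-recFrame = pr-ext ⟨ pr-const 1 , ⟨ var (# 0) , ⟨ var (# 1) , ⟨ var (# 2) , var (# 3) ⟩ᵖ ⟩ᵖ ⟩ᵖ ⟩ᵖ
                     λ { (h ∷ k ∷ m ∷ xs ∷ []) → refl }

pr-nextArg : PrimRecⁿ 5 (uncurry₅ nextArg)
pr-nextArg = pr-ext
  (comp₃ pr-ifz (var (# 1)) (comp₃ pr-evalState (var (# 0)) (var (# 3)) (var (# 4)))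
    (comp₃ pr-evalState (π₁ᵖ (var (# 1))) (var (# 2))
      ⟨ pr-compFrame ∘ᵖ (var (# 0) ∷ π₂ᵖ (var (# 1)) ∷ var (# 2) ∷ var (# 3) ∷ []) , var (# 4) ⟩ᵖ))
  λ { (f ∷ gs ∷ xs ∷ acc ∷ K ∷ []) → refl }

pr-recLoop : PrimRecⁿ 6 (uncurry₆ recLoop)
pr-recLoop = pr-ext
  (pr-ifeq ∘ᵖ (var (# 2) ∷ var (# 3) ∷ comp₂ pr-retState (var (# 0)) (var (# 5))
    ∷ comp₃ pr-evalState (var (# 1)) ⟨ var (# 2) , ⟨ var (# 0) , var (# 4) ⟩ᵖ ⟩ᵖ
        ⟨ pr-recFrame ∘ᵖ (var (# 1) ∷ comp₁ pr-suc (var (# 2)) ∷ var (# 3) ∷ var (# 4) ∷ []) , var (# 5) ⟩ᵖ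
    ∷ []))
  λ { (v ∷ h ∷ k ∷ m ∷ xs ∷ K ∷ []) → refl }

pr-resume : PrimRecⁿ 4 (uncurry₄ resume)
pr-resume = pr-ext
  (comp₃ pr-ifz (var (# 1))
    (pr-nextArg ∘ᵖ (π₁ᵖ b ∷ π₁ᵖ (π₂ᵖ b) ∷ π₁ᵖ (π₂ᵖ (π₂ᵖ b))
                    ∷ ⟨ var (# 0) , π₂ᵖ (π₂ᵖ (π₂ᵖ b)) ⟩ᵖ ∷ var (# 3) ∷ []))
    (pr-recLoop ∘ᵖ (var (# 0) ∷ π₁ᵖ b ∷ π₁ᵖ (π₂ᵖ b) ∷ π₁ᵖ (π₂ᵖ (π₂ᵖ b))
                    ∷ π₂ᵖ (π₂ᵖ (π₂ᵖ b)) ∷ var (# 3) ∷ [])))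
  λ { (v ∷ zero ∷ b ∷ K ∷ []) → refl ; (v ∷ suc _ ∷ b ∷ K ∷ []) → refl }
  where
  b : PrimRecⁿ 4 (λ xs → lookup xs (# 2))
  b = var (# 2)

pr-returnTo : PrimRecⁿ 2 (uncurry₂ returnTo)
pr-returnTo = pr-ext
  (comp₃ pr-ifz (var (# 1)) (comp₂ pr-retState (var (# 0)) (var (# 1)))
    (pr-resume ∘ᵖ (var (# 0) ∷ π₁ᵖ (π₁ᵖ (var (# 1))) ∷ π₂ᵖ (π₁ᵖ (var (# 1)))
                   ∷ π₂ᵖ (var (# 1)) ∷ [])))
  λ { (v ∷ K ∷ []) → refl }

pr-dispatch : PrimRecⁿ 4 (uncurry₄ dispatch)
pr-dispatch = pr-ext
  (comp₃ pr-ifz tag (comp₂ pr-retState pr-zero K)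
  (comp₃ pr-ifz (comp₁ pr-pred tag) (comp₂ pr-retState (comp₁ pr-suc (π₁ᵖ xs)) K)
  (comp₃ pr-ifz (comp₁ pr-pred (comp₁ pr-pred tag)) (comp₂ pr-retState (comp₂ pr-nth p xs) K)
  (comp₃ pr-ifz (comp₁ pr-pred (comp₁ pr-pred (comp₁ pr-pred tag)))
    (pr-nextArg ∘ᵖ (π₁ᵖ p ∷ π₂ᵖ p ∷ xs ∷ pr-zero ∷ K ∷ []))
    (comp₃ pr-evalState (π₁ᵖ p) (π₂ᵖ xs)
      ⟨ pr-recFrame ∘ᵖ (π₂ᵖ p ∷ pr-zero ∷ π₁ᵖ xs ∷ π₂ᵖ xs ∷ []) , K ⟩ᵖ)))))
  λ { (zero ∷ _ ∷ _ ∷ _ ∷ [])                      → refl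
    ; (suc zero ∷ _ ∷ _ ∷ _ ∷ [])                  → refl
    ; (suc (suc zero) ∷ _ ∷ _ ∷ _ ∷ [])            → refl
    ; (suc (suc (suc zero)) ∷ _ ∷ _ ∷ _ ∷ [])      → refl
    ; (suc (suc (suc (suc _))) ∷ _ ∷ _ ∷ _ ∷ [])   → refl }
  where
  tag : PrimRecⁿ 4 (λ v → lookup v (# 0))
  tag = var (# 0)
  p : PrimRecⁿ 4 (λ v → lookup v (# 1))
  p = var (# 1)
  xs : PrimRecⁿ 4 (λ v → lookup v (# 2))
  xs = var (# 2)
  K : PrimRecⁿ 4 (λ v → lookup v (# 3))
  K = var (# 3)

pr-stepWith : PrimRecⁿ 3 (uncurry₃ stepWith)
pr-stepWith = pr-ext
  (comp₃ pr-ifz (var (# 0))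
    (pr-dispatch ∘ᵖ (π₁ᵖ (π₁ᵖ (var (# 1))) ∷ π₂ᵖ (π₁ᵖ (var (# 1))) ∷ π₂ᵖ (var (# 1))
                     ∷ var (# 2) ∷ []))
    (comp₂ pr-returnTo (var (# 1)) (var (# 2))))
  λ { (zero ∷ c ∷ K ∷ []) → refl ; (suc _ ∷ c ∷ K ∷ []) → refl }

pr-step : PrimRecⁿ 1 (uncurry₁ step)
pr-step = pr-ext
  (comp₃ pr-stepWith (π₁ᵖ (π₁ᵖ (var (# 0)))) (π₂ᵖ (π₁ᵖ (var (# 0)))) (π₂ᵖ (var (# 0))))
  λ { (st ∷ []) → refl }

step-⟨⟩ : ∀ c K → step ⟨ c , K ⟩ ≡ stepWith (π₁ c) (π₂ c) K
step-⟨⟩ c K = cong₂ (λ a b → stepWith (π₁ a) (π₂ a) b) (π₁-⟨⟩ c K) (π₂-⟨⟩ c K)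

step-evalState : ∀ e xs K → step (evalState e xs K) ≡ dispatch (π₁ e) (π₂ e) xs K
step-evalState e xs K
  rewrite step-⟨⟩ ⟨ 0 , ⟨ e , xs ⟩ ⟩ K | π₁-⟨⟩ 0 ⟨ e , xs ⟩ | π₂-⟨⟩ 0 ⟨ e , xs ⟩
        | π₁-⟨⟩ e xs | π₂-⟨⟩ e xs = refl

step-retState : ∀ v K → step (retState v K) ≡ returnTo v K
step-retState v K rewrite step-⟨⟩ ⟨ 1 , v ⟩ K | π₁-⟨⟩ 1 v | π₂-⟨⟩ 1 v = refl

returnTo-⟨⟩ : ∀ v fr K → returnTo v ⟨ fr , K ⟩ ≡ resume v (π₁ fr) (π₂ fr) K
returnTo-⟨⟩ v fr K =
  trans (ifz-⟨⟩ fr K _ _) (cong₂ (λ a b → resume v (π₁ a) (π₂ a) b) (π₁-⟨⟩ fr K) (π₂-⟨⟩ fr K))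

step-returnComp : ∀ v f gs xs acc K →
  step (retState v ⟨ compFrame f gs xs acc , K ⟩) ≡ nextArg f gs xs ⟨ v , acc ⟩ K
step-returnComp v f gs xs acc K
  rewrite step-retState v ⟨ compFrame f gs xs acc , K ⟩ | returnTo-⟨⟩ v (compFrame f gs xs acc) K
        | π₁-⟨⟩ 0 ⟨ f , ⟨ gs , ⟨ xs , acc ⟩ ⟩ ⟩ | π₂-⟨⟩ 0 ⟨ f , ⟨ gs , ⟨ xs , acc ⟩ ⟩ ⟩
        | π₁-⟨⟩ f ⟨ gs , ⟨ xs , acc ⟩ ⟩ | π₂-⟨⟩ f ⟨ gs , ⟨ xs , acc ⟩ ⟩
        | π₁-⟨⟩ gs ⟨ xs , acc ⟩ | π₂-⟨⟩ gs ⟨ xs , acc ⟩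
        | π₁-⟨⟩ xs acc | π₂-⟨⟩ xs acc = refl

step-returnRec : ∀ v h k m xs K →
  step (retState v ⟨ recFrame h k m xs , K ⟩) ≡ recLoop v h k m xs K
step-returnRec v h k m xs K
  rewrite step-retState v ⟨ recFrame h k m xs , K ⟩ | returnTo-⟨⟩ v (recFrame h k m xs) K
        | π₁-⟨⟩ 1 ⟨ h , ⟨ k , ⟨ m , xs ⟩ ⟩ ⟩ | π₂-⟨⟩ 1 ⟨ h , ⟨ k , ⟨ m , xs ⟩ ⟩ ⟩
        | π₁-⟨⟩ h ⟨ k , ⟨ m , xs ⟩ ⟩ | π₂-⟨⟩ h ⟨ k , ⟨ m , xs ⟩ ⟩
        | π₁-⟨⟩ k ⟨ m , xs ⟩ | π₂-⟨⟩ k ⟨ m , xs ⟩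
        | π₁-⟨⟩ m xs | π₂-⟨⟩ m xs = refl

infix 4 _↝_
_↝_ : ℕ → ℕ → Set
s ↝ t = ∃ λ k → fold s step k ≡ t

↝-refl : ∀ {s} → s ↝ s
↝-refl = 0 , refl

↝-step : ∀ {s t} → step s ≡ t → s ↝ t
↝-step e = 1 , e

infixr 4 _▸_
_▸_ : ∀ {s t u} → s ↝ t → t ↝ u → s ↝ u
(a , p) ▸ (b , q) = b + a , trans (fold-+ _ step b) (trans (cong (λ z → fold z step b) p) q)

mutual
  evalState-↝ : ∀ {n} e xs K → e < n → evalState e xs K ↝ retState (eval n e xs) K
  evalState-↝ {suc n} zero xs K _ rewrite π₁-zero =
    ↝-step (trans (step-evalState 0 xs K) (cong (λ t → dispatch t (π₂ 0) xs K) π₁-zero))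
  evalState-↝ {suc n} (suc e) xs K (s≤s e<n) =
    ↝-step (step-evalState (suc e) xs K) ▸ dispatch-↝ (π₁ (suc e)) xs K (<-≤-trans (π₂-< e) e<n)

  dispatch-↝ : ∀ {n p} tag xs K → p < n → dispatch tag p xs K ↝ retState (evalBody n tag p xs) K
  dispatch-↝ zero                   xs K p<n = ↝-refl
  dispatch-↝ (suc zero)             xs K p<n = ↝-refl
  dispatch-↝ (suc (suc zero))       xs K p<n = ↝-refl
  dispatch-↝ {p = p} (suc (suc (suc zero))) xs K p<n =
    nextArg-↝ (π₂ p) (π₁ p) (π₂ p) xs 0 K ≤-refl (≤-<-trans (π₂-≤ p) p<n)
    ▸ evalState-↝ (π₁ p) _ K (≤-<-trans (π₁-≤ p) p<n)
  dispatch-↝ {p = p} (suc (suc (suc (suc _)))) xs K p<n =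
    evalState-↝ (π₁ p) (π₂ xs) _ (≤-<-trans (π₁-≤ p) p<n)
    ▸ recLoop-↝ (π₂ p) (π₂ xs) _ (π₁ xs) K refl (≤-<-trans (π₂-≤ p) p<n)

  recLoop-↝ : ∀ {n} h xs z j {k m} K → k + j ≡ m → h < n →
    retState (evalRec n h xs z k) ⟨ recFrame h k m xs , K ⟩ ↝ retState (evalRec n h xs z m) K
  recLoop-↝ h xs z zero {k} K refl h<n rewrite +-identityʳ k =
    ↝-step (trans (step-returnRec _ h k k xs K) (ifeq-≡ k _ _))
  recLoop-↝ h xs z (suc j) {k} K refl h<n =
    ↝-step (trans (step-returnRec _ h k _ xs K) (ifeq-≢ _ _ λ eq → m≢1+m+n k (trans eq (+-suc k j))))
    ▸ evalState-↝ h _ _ h<n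
    ▸ recLoop-↝ h xs z j K (sym (+-suc k j)) h<n

  nextArg-↝ : ∀ {n} m f gs xs acc K → gs ≤ m → gs < n →
    nextArg f gs xs acc K ↝ evalState f (evalArgs n m gs xs acc) K
  nextArg-↝ zero    f zero    xs acc K _ _ = ↝-refl
  nextArg-↝ (suc m) f zero    xs acc K _ _ = ↝-refl
  nextArg-↝ (suc m) f (suc g) xs acc K (s≤s g≤m) g<n =
    evalState-↝ (π₁ (suc g)) xs _ (<-trans (π₁-< g) g<n)
    ▸ ↝-step (step-returnComp _ f (π₂ (suc g)) xs acc K)
    ▸ nextArg-↝ m f (π₂ (suc g)) xs _ K (≤-trans (≤-pred (π₂-< g)) g≤m) (<-trans (π₂-< g) g<n)

-- 0 exactly at the halted states: a value returned to the empty stack.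
running : ℕ → ℕ
running st = ifz (π₁ (π₁ st)) 1 (ifz (π₂ st) 0 1)

output : ℕ → ℕ
output st = π₂ (π₁ st)

running-retState : ∀ v → running (retState v 0) ≡ 0
running-retState v rewrite π₁-⟨⟩ ⟨ 1 , v ⟩ 0 | π₁-⟨⟩ 1 v | π₂-⟨⟩ ⟨ 1 , v ⟩ 0 = refl

output-retState : ∀ v K → output (retState v K) ≡ v
output-retState v K = trans (cong π₂ (π₁-⟨⟩ ⟨ 1 , v ⟩ K)) (π₂-⟨⟩ 1 v)

step-halted : ∀ st → running st ≡ 0 → step st ≡ retState (output st) 0
step-halted st = halts (π₁ (π₁ st)) (π₂ (π₁ st)) (π₂ st)
  where
  halts : ∀ mode v K → ifz mode 1 (ifz K 0 1) ≡ 0 → stepWith mode v K ≡ retState v 0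
  halts (suc _) v zero    _ = refl
  halts zero    v K       ()
  halts (suc _) v (suc _) ()

fold-halted : ∀ st → running st ≡ 0 → ∀ d → fold st step (suc d) ≡ retState (output st) 0
fold-halted st halt zero    = step-halted st halt
fold-halted st halt (suc d) = trans (cong step (fold-halted st halt d)) (step-retState (output st) 0)

output-halted : ∀ st → running st ≡ 0 → ∀ d → output (fold st step d) ≡ output st
output-halted st halt zero    = refl
output-halted st halt (suc d) = trans (cong output (fold-halted st halt d)) (output-retState _ 0)

output-firstHalt : ∀ st {k n v} → running (fold st step k) ≡ 0 →
                   (∀ j → j < k → running (fold st step j) ≢ 0) →
                   fold st step n ≡ retState v 0 → output (fold st step k) ≡ v
output-firstHalt st {k} {n} {v} halt before reach = begin
  output (fold st step k)                       ≡⟨ sym (output-halted _ halt d) ⟩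
  output (fold (fold st step k) step d)         ≡⟨ cong output (sym (fold-+ st step d)) ⟩
  output (fold st step (d + k))
    ≡⟨ cong (λ t → output (fold st step t)) (trans (+-comm d k) k+d≡n) ⟩
  output (fold st step n)                       ≡⟨ cong output reach ⟩
  output (retState v 0)                         ≡⟨ output-retState v 0 ⟩
  v                                             ∎
  where
  open ≡-Reasoning
  k≤n : k ≤ n
  k≤n = ≮⇒≥ λ n<k → before n n<k (trans (cong running reach) (running-retState v))
  d = n ∸ k
  k+d≡n : k + d ≡ n
  k+d≡n = m+[n∸m]≡n k≤n

start : ℕ → ℕ
start e = evalState e ⟨ e , 0 ⟩ 0

selfApp : ℕ → ℕ
selfApp e = eval (suc e) e ⟨ e , 0 ⟩

selfApp-computable : Computable selfApp
selfApp-computable = minimise-computable pr-runningAt pr-outputAt firstHalt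
  where
  runAt : ℕ → ℕ → ℕ
  runAt s e = fold (start e) step s
  pr-runAt : PrimRecⁿ 2 (uncurry₂ runAt)
  pr-runAt = pr-ext (comp₂ (pr-fold pr-step) (var (# 0))
                           (comp₃ pr-evalState (var (# 1)) ⟨ var (# 1) , pr-zero ⟩ᵖ pr-zero))
                    λ { (s ∷ e ∷ []) → refl }
  pr-runningAt : PrimRecⁿ 2 (uncurry₂ λ s e → running (runAt s e))
  pr-runningAt = pr-ext (comp₃ pr-ifz (π₁ᵖ (π₁ᵖ pr-runAt)) (pr-const 1)
                                      (comp₃ pr-ifz (π₂ᵖ pr-runAt) pr-zero (pr-const 1)))
                        λ { (s ∷ e ∷ []) → refl }
  pr-outputAt : PrimRecⁿ 2 (uncurry₂ λ s e → output (runAt s e))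
  pr-outputAt = pr-ext (π₂ᵖ (π₁ᵖ pr-runAt)) λ { (s ∷ e ∷ []) → refl }
  firstHalt : ∀ e → ∃ λ s → running (runAt s e) ≡ 0 × (∀ j → j < s → running (runAt j e) ≢ 0) ×
                            output (runAt s e) ≡ selfApp e
  firstHalt e with evalState-↝ e ⟨ e , 0 ⟩ 0 ≤-refl
  ... | n , reach
    with least (λ s → running (runAt s e) ≟ 0) {n} (trans (cong running reach) (running-retState _))
  ...   | s , halt , before = s , halt , before , output-firstHalt (start e) {n = n} halt before reach

isZeroBit : ℕ → ℕ
isZeroBit u = b2n (u ≡ᵇ 0)

hasLeaf : ℕ → Bool
hasLeaf i = selfApp i ≡ᵇ 0

branchBit : ℕ → ℕ
branchBit i = b2n (hasLeaf i)

pr-isZeroBit : PrimRecⁿ 1 (uncurry₁ isZeroBit)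
pr-isZeroBit = pr-ext (comp₃ pr-ifz (var (# 0)) (pr-const 1) pr-zero)
                      λ { (zero ∷ []) → refl ; (suc _ ∷ []) → refl }

isZeroBit-no-fixpoint : ∀ u → u ≢ isZeroBit u
isZeroBit-no-fixpoint zero    ()
isZeroBit-no-fixpoint (suc u) ()

selfApp-encode : ∀ (c : PR 1) → selfApp ⌜ c ⌝ ≡ ⟦ c ⟧ (⌜ c ⌝ ∷ [])
selfApp-encode c = eval-encode c ≤-refl (⌜ c ⌝ ∷ [])

branchBit-not-primRec : ∀ {g} → PrimRecⁿ 1 (uncurry₁ g) → ¬ (∀ i → g i ≡ branchBit i)
branchBit-not-primRec {g} (c , ⟦c⟧≡g) g≗branch = isZeroBit-no-fixpoint (selfApp e) (begin
  selfApp e          ≡⟨ selfApp-encode c ⟩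
  ⟦ c ⟧ (e ∷ [])     ≡⟨ ⟦c⟧≡g (e ∷ []) ⟩
  g e                ≡⟨ g≗branch e ⟩
  isZeroBit (selfApp e) ∎)
  where
  open ≡-Reasoning
  e = ⌜ c ⌝

-- relAfter i l decides R (0 ∷ replicate i 0 ++ l).
relAfter : ℕ → List ℕ → Bool
relAfter i []                       = true
relAfter i (zero ∷ l)               = relAfter (suc i) l
relAfter i (suc zero ∷ [])          = hasLeaf i
relAfter i (suc zero ∷ _ ∷ _)       = false
relAfter i (suc (suc _) ∷ _)        = false

treeRel : List ℕ → Bool
treeRel []          = false
treeRel (zero ∷ l)  = relAfter 0 l
treeRel (suc _ ∷ _) = false

tree : Str
tree = record { dom = λ _ → true ; rel = treeRel ; root = 0 }

relAfter-replicate : ∀ n i l → relAfter i (replicate n 0 ++ l) ≡ relAfter (n + i) l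
relAfter-replicate zero    i l = refl
relAfter-replicate (suc n) i l =
  trans (relAfter-replicate n (suc i) l) (cong (λ t → relAfter t l) (+-suc n i))

relAfter-take : ∀ i l n → relAfter i l ≡ true → relAfter i (take n l) ≡ true
relAfter-take i l                  zero          _ = refl
relAfter-take i []                 (suc n)       _ = refl
relAfter-take i (zero ∷ l)         (suc n)       r = relAfter-take (suc i) l n r
relAfter-take i (suc zero ∷ [])    (suc zero)    r = r
relAfter-take i (suc zero ∷ [])    (suc (suc _)) r = r
relAfter-take i (suc zero ∷ _ ∷ _) (suc n)       ()
relAfter-take i (suc (suc _) ∷ _)  (suc n)       ()

all-true : (xs : List ℕ) → All (λ x → true ≡ true) xs
all-true []       = []
all-true (x ∷ xs) = refl ∷ all-true xs

tree-isPrefixTree : IsPrefixTree tree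
tree-isPrefixTree = record
  { root-dom = refl
  ; rel-dom  = λ xs _ → all-true xs
  ; R₁-root  = refl
  ; R₁-only  = λ { zero _ → refl ; (suc _) () }
  ; prefix   = λ { (zero ∷ l) r (suc n) _ _ → relAfter-take 0 l n r ; [] () ; (suc _ ∷ _) () }
  }

tree-infinite : Infinite tree
tree-infinite n = n , ≤-refl , refl

parity : ℕ → ℕ
parity zero    = 0
parity (suc n) = 1 ∸ parity n

half : ℕ → ℕ
half zero    = 0
half (suc n) = half n + parity n

parity-double : ∀ c → parity (c + c) ≡ 0
parity-double zero    = refl
parity-double (suc c) rewrite +-suc c c | parity-double c = refl

half-double : ∀ c → half (c + c) ≡ c
half-double zero    = refl
half-double (suc c) rewrite +-suc c c | parity-double c | half-double c | +-identityʳ c = +-comm c 1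

parity-double+1 : ∀ c → parity (suc (c + c)) ≡ 1
parity-double+1 c rewrite parity-double c = refl

half-double+1 : ∀ c → half (suc (c + c)) ≡ c
half-double+1 c rewrite parity-double c | half-double c = +-identityʳ c

code-zero : ∀ l → code (0 ∷ l) ≡ suc (code l + code l)
code-zero l = trans (+-identityʳ (2 * code l + 1))
                    (trans (+-comm (2 * code l) 1) (cong (λ t → suc (code l + t)) (+-identityʳ (code l))))

code-suc : ∀ h l → code (suc h ∷ l) ≡ code (h ∷ l) + code (h ∷ l)
code-suc h l = trans (*-assoc 2 (2 ^ h) (2 * code l + 1)) (cong (code (h ∷ l) +_) (+-identityʳ _))

code-cons-≥1 : ∀ h l → 1 ≤ code (h ∷ l)
code-cons-≥1 zero    l rewrite code-zero l = s≤s z≤n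
code-cons-≥1 (suc h) l rewrite code-suc h l = ≤-trans (code-cons-≥1 h l) (m≤m+n _ _)

-- In a state ⟨ w , i ⟩, w is the code of what is left of a tuple after its first i + 1 zeros.
-- As code (0 ∷ l) = 2 · code l + 1, removing a leading zero halves an odd code.
stripZero : ℕ → ℕ
stripZero st = ifz (parity (π₁ st)) st ⟨ half (π₁ st) , suc (π₂ st) ⟩

stripZero-even : ∀ c i → stripZero ⟨ c + c , i ⟩ ≡ ⟨ c + c , i ⟩
stripZero-even c i rewrite π₁-⟨⟩ (c + c) i | parity-double c = refl

stripZero-odd : ∀ c i → stripZero ⟨ suc (c + c) , i ⟩ ≡ ⟨ c , suc i ⟩
stripZero-odd c i rewrite π₁-⟨⟩ (suc (c + c)) i | π₂-⟨⟩ (suc (c + c)) i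
                        | parity-double+1 c | half-double+1 c = refl

-- code [] = 0 and code (1 ∷ []) = 2.
verdict : ℕ → ℕ → ℕ
verdict w x = ifz w 1 (ifeq w 2 x 0)

verdict-≥4 : ∀ {w} x → 4 ≤ w → verdict w x ≡ 0
verdict-≥4 {suc w} x (s≤s 3≤w) = ifeq-≢ {suc w} {2} x 0 λ { refl → case 3≤w }
  where
  case : ¬ 3 ≤ 1
  case (s≤s ())

leadingZeros : List ℕ → ℕ
leadingZeros (zero ∷ l) = suc (leadingZeros l)
leadingZeros _          = 0

leadingZeros-≤ : ∀ l → leadingZeros l ≤ code l
leadingZeros-≤ []          = z≤n
leadingZeros-≤ (zero ∷ l) rewrite code-zero l = s≤s (≤-trans (leadingZeros-≤ l) (m≤m+n _ _))
leadingZeros-≤ (suc h ∷ l) = z≤n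

verdictOf : ℕ → ℕ
verdictOf st = verdict (π₁ st) (branchBit (π₂ st))

parse : ℕ → ℕ → ℕ → ℕ
parse k w i = verdictOf (fold ⟨ w , i ⟩ stripZero k)

parse-even : ∀ k c i → parse k (c + c) i ≡ verdict (c + c) (branchBit i)
parse-even k c i = trans (cong verdictOf (fold-fixed (stripZero-even c i) k))
                         (cong₂ verdict (π₁-⟨⟩ (c + c) i) (cong branchBit (π₂-⟨⟩ (c + c) i)))

parse-double : ∀ k {c} i → 2 ≤ c → parse k (c + c) i ≡ 0
parse-double k {c} i c≥2 = trans (parse-even k c i) (verdict-≥4 _ (+-mono-≤ c≥2 c≥2))

parse-correct : ∀ l i k → leadingZeros l ≤ k → parse k (code l) i ≡ b2n (relAfter i l)
parse-correct [] i k _ = parse-even k 0 i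
parse-correct (zero ∷ l) i (suc k) (s≤s lz≤k) rewrite code-zero l =
  trans (cong verdictOf (trans (fold-suc _ stripZero k)
                               (cong (λ z → fold z stripZero k) (stripZero-odd (code l) i))))
        (parse-correct l (suc i) k lz≤k)
parse-correct (suc zero ∷ []) i k _ = parse-even k 1 i
parse-correct (suc zero ∷ x ∷ l) i k _ rewrite code-suc 0 (x ∷ l) = parse-double k i (begin
  2                              ≤⟨ s≤s (code-cons-≥1 x l) ⟩
  suc (code (x ∷ l))             ≤⟨ s≤s (m≤m+n _ _) ⟩
  suc (code (x ∷ l) + code (x ∷ l)) ≡⟨ sym (code-zero (x ∷ l)) ⟩
  code (0 ∷ x ∷ l)               ∎)
  where open ≤-Reasoning
parse-correct (suc (suc h) ∷ l) i k _ rewrite code-suc (suc h) l =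
  parse-double k i (subst (2 ≤_) (sym (code-suc h l)) (+-mono-≤ (code-cons-≥1 h l) (code-cons-≥1 h l)))

afterRoot : ℕ → ℕ
afterRoot z = fold ⟨ half z , 0 ⟩ stripZero z

treeRelCodeWith : ℕ → ℕ → ℕ
treeRelCodeWith z x = ifz (parity z) 0 (verdict (π₁ (afterRoot z)) x)

treeRelCode : ℕ → ℕ
treeRelCode z = treeRelCodeWith z (branchBit (π₂ (afterRoot z)))

treeRelCode-code : ∀ xs → treeRelCode (code xs) ≡ b2n (treeRel xs)
treeRelCode-code [] = refl
treeRelCode-code (zero ∷ l) = begin
  treeRelCode (code (0 ∷ l))                      ≡⟨ cong treeRelCode (code-zero l) ⟩
  treeRelCode (suc (c + c))
    ≡⟨ cong (λ b → ifz b 0 (parse (suc (c + c)) (half (suc (c + c))) 0)) (parity-double+1 c) ⟩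
  parse (suc (c + c)) (half (suc (c + c))) 0
    ≡⟨ cong (λ w → parse (suc (c + c)) w 0) (half-double+1 c) ⟩
  parse (suc (c + c)) c 0
    ≡⟨ parse-correct l 0 _ (≤-trans (leadingZeros-≤ l) (≤-trans (m≤m+n c c) (n≤1+n _))) ⟩
  b2n (relAfter 0 l)                              ∎
  where
  open ≡-Reasoning
  c = code l
treeRelCode-code (suc h ∷ l) = begin
  treeRelCode (code (suc h ∷ l))  ≡⟨ cong treeRelCode (code-suc h l) ⟩
  treeRelCode (c + c)             ≡⟨ cong (λ b → ifz b 0 (parse (c + c) (half (c + c)) 0)) (parity-double c) ⟩
  0                               ∎
  where
  open ≡-Reasoning
  c = code (h ∷ l)

pr-parity : PrimRecⁿ 1 (uncurry₁ parity)
pr-parity = pr-rec _ pr-zero (comp₂ pr-∸ (pr-const 1) (var (# 1)))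
                    (λ { [] → refl }) (λ { k [] → refl })

pr-half : PrimRecⁿ 1 (uncurry₁ half)
pr-half = pr-rec _ pr-zero (comp₂ pr-+ (var (# 1)) (comp₁ pr-parity (var (# 0))))
                  (λ { [] → refl }) (λ { k [] → refl })

pr-afterRoot : PrimRecⁿ 1 (uncurry₁ afterRoot)
pr-afterRoot = pr-ext (comp₂ (pr-fold pr-stripZero) (var (# 0)) ⟨ comp₁ pr-half (var (# 0)) , pr-zero ⟩ᵖ)
                      λ { (z ∷ []) → refl }
  where
  pr-stripZero : PrimRecⁿ 1 (uncurry₁ stripZero)
  pr-stripZero = pr-ext
    (comp₃ pr-ifz (comp₁ pr-parity (π₁ᵖ (var (# 0)))) (var (# 0))
                  ⟨ comp₁ pr-half (π₁ᵖ (var (# 0))) , comp₁ pr-suc (π₂ᵖ (var (# 0))) ⟩ᵖ)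
    λ { (st ∷ []) → refl }

pr-treeRelCodeWith : PrimRecⁿ 2 (uncurry₂ treeRelCodeWith)
pr-treeRelCodeWith = pr-ext
  (comp₃ pr-ifz (comp₁ pr-parity (var (# 0))) pr-zero
    (comp₃ pr-ifz w (pr-const 1) (pr-ifeq ∘ᵖ (w ∷ pr-const 2 ∷ var (# 1) ∷ pr-zero ∷ []))))
  λ { (z ∷ x ∷ []) → refl }
  where
  w : PrimRecⁿ 2 (λ xs → π₁ (afterRoot (lookup xs (# 0))))
  w = π₁ᵖ (comp₁ pr-afterRoot (var (# 0)))

branchBit-computable : Computable branchBit
branchBit-computable = computable-∘ (primRec⇒computable pr-isZeroBit) selfApp-computable

tree-computable : IsComputable tree
tree-computable = primRec⇒computable (pr-const 1) , treeRelCode ,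
  computable-app pr-treeRelCodeWith
    (computable-∘ branchBit-computable (primRec⇒computable (π₂ᵖ pr-afterRoot))) ,
  treeRelCode-code

spineLeaf : ℕ → List ℕ
spineLeaf i = 0 ∷ replicate i 0 ++ 1 ∷ []

treeRel-spineLeaf : ∀ i → treeRel (spineLeaf i) ≡ hasLeaf i
treeRel-spineLeaf i =
  trans (relAfter-replicate i 0 (1 ∷ [])) (cong (λ t → relAfter t (1 ∷ [])) (+-identityʳ i))

pr-code-replicate : ∀ a b → PrimRecⁿ 1 (uncurry₁ λ n → code (replicate n a ++ b ∷ []))
pr-code-replicate a b = pr-rec _ (pr-const (code (b ∷ [])))
  (comp₂ pr-* (pr-const (2 ^ a)) (comp₂ pr-+ (comp₂ pr-* (pr-const 2) (var (# 1))) (pr-const 1)))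
  (λ { [] → refl }) (λ { k [] → refl })

punctual-branchBit : ∀ B → IsPunctual B → Iso tree B →
                     ∃ λ g → PrimRecⁿ 1 (uncurry₁ g) × (∀ i → g i ≡ branchBit i)
punctual-branchBit B (_ , relB , (c , ⟦c⟧≡relB) , relB-code) iso =
  g , pr-g , g≗branchBit
  where
  open Iso iso
  ρ = root B
  β = f 1
  g : ℕ → ℕ
  g i = relB (code (replicate (suc i) ρ ++ β ∷ []))
  pr-g : PrimRecⁿ 1 (uncurry₁ g)
  pr-g = pr-ext
    (comp₁ (c , λ { (x ∷ []) → ⟦c⟧≡relB x }) (comp₁ (pr-code-replicate ρ β) (comp₁ pr-suc (var (# 0)))))
    λ { (i ∷ []) → refl }
  map-spineLeaf : ∀ i → map f (spineLeaf i) ≡ replicate (suc i) ρ ++ β ∷ []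
  map-spineLeaf i rewrite map-++ f (replicate i 0) (1 ∷ []) | map-replicate f i 0 | f-root = refl
  g≗branchBit : ∀ i → g i ≡ branchBit i
  g≗branchBit i = begin
    relB (code (replicate (suc i) ρ ++ β ∷ []))  ≡⟨ cong (relB ∘ code) (sym (map-spineLeaf i)) ⟩
    relB (code (map f (spineLeaf i)))            ≡⟨ relB-code _ ⟩
    b2n (rel B (map f (spineLeaf i)))            ≡⟨ cong b2n (sym (f-rel _ (λ ()) (all-true _))) ⟩
    b2n (treeRel (spineLeaf i))                  ≡⟨ cong b2n (treeRel-spineLeaf i) ⟩
    branchBit i                                  ∎
    where open ≡-Reasoning

tree-not-punctual : ∀ B → IsPrefixTree B → IsPunctual B → ¬ Iso tree B
tree-not-punctual B _ punctual iso =
  let (g , pr-g , g≗branchBit) = punctual-branchBit B punctual iso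
  in branchBit-not-primRec pr-g g≗branchBit

theorem32 : Σ Str λ A → IsPrefixTree A × Infinite A × IsComputable A ×
                (∀ B → IsPrefixTree B → IsPunctual B → ¬ Iso A B)
theorem32 = tree , tree-isPrefixTree , tree-infinite , tree-computable , tree-not-punctual
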